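{- Let $A$ be a good pseudo-hoop and let $F$ be a filter of $A$. The following are equivalent: (a) $F$ is an involutive filter of $A$; (b) $(y^{ - }\rightsquigarrow x^{ - })\rightarrow (x\rightarrow y)\in F$ and $(y^{\sim}\rightarrow x^{\sim})\rightsquigarrow (x\rightsquigarrow y)\in F$ for all $x,y\in A$; (c) $(x^{ - }\rightsquigarrow y)\rightarrow (y^{\sim}\rightarrow x)\in F$ and $(x^{\sim}\rightarrow y)\rightsquigarrow (y^{ - }\rightsquigarrow x)\in F$ for all $x,y\in A$.
   Context: A pseudo-hoop is an algebra $(A,\odot,\rightarrow,\rightsquigarrow,1)$ of type $(2,2,2,0)$ such that for all $x,y,z\in A$: $x\odot 1=1\odot x=x$; $x\rightarrow x=x\rightsquigarrow x=1$; $(x\odot y)\rightarrow z=x\rightarrow(y\rightarrow z)$; $(x\odot y)\rightsquigarrow z=y\rightsquigarrow(x\rightsquigarrow z)$; $(x\rightarrow y)\odot x=(y\rightarrow x)\odot y=x\odot(x\rightsquigarrow y)=y\odot(y\rightsquigarrow x)$. The order is $x\le y$ iff $x\rightarrow y=1$. It is bounded if it has a least element $0$; then $x^-=x\rightarrow 0$, $x^\sim=x\rightsquigarrow 0$, $x^{ -\sim}=(x^-)^\sim$, $x^{\sim- }=(x^\sim)^-$. A bounded pseudo-hoop is good if $x^{ -\sim}=x^{\sim- }$ for all $x$. A filter is a nonempty $F\subseteq A$ closed under $\odot$ and upward closed; it is involutive if $x^{ -\sim}\rightarrow x\in F$ and $x^{\sim- }\rightsquigarrow x\in F$ for all $x\in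 A$. -}

module Defs where

open import Level using (Level; suc; _⊔_)
open import Relation.Binary.PropositionalEquality using (_≡_)
open import Data.Product using (_×_; ∃)

record PseudoHoop (a : Level) : Set (suc a) where
  infixl 7 _⊙_
  infixr 5 _⇒_ _⇝_
  field
    Carrier : Set a
    _⊙_ : Carrier → Carrier → Carrier
    _⇒_ : Carrier → Carrier → Carrier
    _⇝_ : Carrier → Carrier → Carrier
    𝟙   : Carrier
    ⊙-identityʳ : ∀ x → x ⊙ 𝟙 ≡ x
    ⊙-identityˡ : ∀ x → 𝟙 ⊙ x ≡ x
    ⇒-refl : ∀ x → x ⇒ x ≡ 𝟙
    ⇝-refl : ∀ x → x ⇝ x ≡ 𝟙
    ⇒-curry : ∀ x y z → (x ⊙ y) ⇒ z ≡ x ⇒ (y ⇒ z)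
    ⇝-curry : ∀ x y z → (x ⊙ y) ⇝ z ≡ y ⇝ (x ⇝ z)
    div₁ : ∀ x y → (x ⇒ y) ⊙ x ≡ (y ⇒ x) ⊙ y
    div₂ : ∀ x y → (y ⇒ x) ⊙ y ≡ x ⊙ (x ⇝ y)
    div₃ : ∀ x y → x ⊙ (x ⇝ y) ≡ y ⊙ (y ⇝ x)

  _≤_ : Carrier → Carrier → Set a
  x ≤ y = x ⇒ y ≡ 𝟙

record BoundedPseudoHoop (a : Level) : Set (suc a) where
  field
    pseudoHoop : PseudoHoop a
  open PseudoHoop pseudoHoop public
  field
    𝟘 : Carrier
    𝟘-least : ∀ x → 𝟘 ≤ x

  infix 9 _⁻ _∼
  _⁻ : Carrier → Carrier
  x ⁻ = x ⇒ 𝟘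
  _∼ : Carrier → Carrier
  x ∼ = x ⇝ 𝟘

IsGood : ∀ {a} → BoundedPseudoHoop a → Set a
IsGood A = ∀ x → (x ⁻) ∼ ≡ (x ∼) ⁻
  where open BoundedPseudoHoop A

record IsFilter {a ℓ} (A : PseudoHoop a) (F : PseudoHoop.Carrier A → Set ℓ) : Set (a ⊔ ℓ) where
  open PseudoHoop A
  field
    nonempty : ∃ F
    ⊙-closed : ∀ {x y} → F x → F y → F (x ⊙ y)
    up-closed : ∀ {x y} → F x → x ≤ y → F y

IsInvolutive : ∀ {a ℓ} (A : BoundedPseudoHoop a) → (BoundedPseudoHoop.Carrier A → Set ℓ) → Set (a ⊔ ℓ)
IsInvolutive A F = ∀ x → F (((x ⁻) ∼) ⇒ x) × F (((x ∼) ⁻) ⇝ x)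
  where open BoundedPseudoHoop A

-- Everything follows from residuation. For (a) ⇒ (b), (c): contraposition gives
-- y⁻ ⇝ x⁻ ≤ x⁻∼ ⇒ y⁻∼ ≤ x ⇒ y⁻∼ and x⁻ ⇝ y ≤ y∼ ⇒ x⁻∼, and since y ⇒ z ≤ w ⇒ (x ⇒ z)
-- whenever w ≤ x ⇒ y, the required elements lie above the involutive ones y⁻∼ ⇒ y
-- resp. x⁻∼ ⇒ x. Conversely, instantiating (b) at x := x⁻∼, y := x, or (c) at y := x⁻,
-- makes the premise 𝟙, leaving exactly x⁻∼ ⇒ x.
module Submission where

open import Defs
open import Data.Product using (_×_; _,_; proj₁; proj₂)
open import Function.Bundles using (_⇔_; mk⇔)
open import Relation.Binary.PropositionalEquality

module PseudoHoopProperties {a} (P : PseudoHoop a) where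
  open PseudoHoop P
  open ≡-Reasoning

  ⊙-⇒-cancel : ∀ {x y} → x ≤ y → x ≡ (y ⇒ x) ⊙ y
  ⊙-⇒-cancel {x} {y} x≤y = begin
    x            ≡⟨ sym (⊙-identityˡ x) ⟩
    𝟙 ⊙ x        ≡⟨ cong (_⊙ x) (sym x≤y) ⟩
    (x ⇒ y) ⊙ x  ≡⟨ div₁ x y ⟩
    (y ⇒ x) ⊙ y  ∎

  ≤-antisym : ∀ {x y} → x ≤ y → y ≤ x → x ≡ y
  ≤-antisym {x} {y} x≤y y≤x = begin
    x            ≡⟨ ⊙-⇒-cancel x≤y ⟩
    (y ⇒ x) ⊙ y  ≡⟨ cong (_⊙ y) y≤x ⟩
    𝟙 ⊙ y        ≡⟨ ⊙-identityˡ y ⟩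
    y            ∎

  ≤-refl : ∀ {x} → x ≤ x
  ≤-refl {x} = ⇒-refl x

  ≤-curry : ∀ {x y z} → (x ⊙ y) ≤ z → x ≤ (y ⇒ z)
  ≤-curry {x} {y} {z} = trans (sym (⇒-curry x y z))

  ≤-uncurry : ∀ {x y z} → x ≤ (y ⇒ z) → (x ⊙ y) ≤ z
  ≤-uncurry {x} {y} {z} = trans (⇒-curry x y z)

  ⇒-mp : ∀ {x y} → ((x ⇒ y) ⊙ x) ≤ y
  ⇒-mp = ≤-uncurry ≤-refl

  𝟙⇒x≡x : ∀ x → 𝟙 ⇒ x ≡ x
  𝟙⇒x≡x x = ≤-antisym 𝟙⇒x≤x x≤𝟙⇒x
    where
    𝟙⇒x≤x : (𝟙 ⇒ x) ≤ x
    𝟙⇒x≤x = subst (_≤ x) (⊙-identityʳ (𝟙 ⇒ x)) ⇒-mp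
    x≤𝟙⇒x : x ≤ (𝟙 ⇒ x)
    x≤𝟙⇒x = ≤-curry (subst (_≤ x) (sym (⊙-identityʳ x)) ≤-refl)

  x⇒𝟙≡𝟙 : ∀ x → x ⇒ 𝟙 ≡ 𝟙
  x⇒𝟙≡𝟙 x = begin
    x ⇒ 𝟙              ≡⟨ cong₂ _⇒_ (sym (𝟙⇒x≡x x)) (sym (⇒-refl 𝟙)) ⟩
    (𝟙 ⇒ x) ⇒ (𝟙 ⇒ 𝟙)  ≡⟨ sym (⇒-curry _ _ _) ⟩
    ((𝟙 ⇒ x) ⊙ 𝟙) ⇒ 𝟙  ≡⟨ cong (_⇒ 𝟙) (div₁ 𝟙 x) ⟩
    ((x ⇒ 𝟙) ⊙ x) ⇒ 𝟙  ≡⟨ ⇒-mp ⟩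
    𝟙                  ∎

  ≤-trans : ∀ {x y z} → x ≤ y → y ≤ z → x ≤ z
  ≤-trans {x} {y} {z} x≤y y≤z = begin
    x ⇒ z              ≡⟨ cong (_⇒ z) (⊙-⇒-cancel x≤y) ⟩
    ((y ⇒ x) ⊙ y) ⇒ z  ≡⟨ ⇒-curry _ _ _ ⟩
    (y ⇒ x) ⇒ (y ⇒ z)  ≡⟨ cong ((y ⇒ x) ⇒_) y≤z ⟩
    (y ⇒ x) ⇒ 𝟙        ≡⟨ x⇒𝟙≡𝟙 _ ⟩
    𝟙                  ∎

  ⊙-⇝-cancel : ∀ {x y} → x ≤ y → x ≡ y ⊙ (y ⇝ x)
  ⊙-⇝-cancel {x} {y} x≤y = begin
    x            ≡⟨ ⊙-⇒-cancel x≤y ⟩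
    (y ⇒ x) ⊙ y  ≡⟨ div₂ x y ⟩
    x ⊙ (x ⇝ y)  ≡⟨ div₃ x y ⟩
    y ⊙ (y ⇝ x)  ∎

  𝟙⇝x≡x : ∀ x → 𝟙 ⇝ x ≡ x
  𝟙⇝x≡x x = begin
    𝟙 ⇝ x        ≡⟨ sym (⊙-identityˡ _) ⟩
    𝟙 ⊙ (𝟙 ⇝ x)  ≡⟨ sym (div₂ 𝟙 x) ⟩
    (x ⇒ 𝟙) ⊙ x  ≡⟨ cong (_⊙ x) (x⇒𝟙≡𝟙 x) ⟩
    𝟙 ⊙ x        ≡⟨ ⊙-identityˡ x ⟩
    x            ∎

  x⇝𝟙≡𝟙 : ∀ x → x ⇝ 𝟙 ≡ 𝟙
  x⇝𝟙≡𝟙 x = begin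
    x ⇝ 𝟙              ≡⟨ cong₂ _⇝_ (sym (𝟙⇝x≡x x)) (sym (⇝-refl 𝟙)) ⟩
    (𝟙 ⇝ x) ⇝ (𝟙 ⇝ 𝟙)  ≡⟨ sym (⇝-curry _ _ _) ⟩
    (𝟙 ⊙ (𝟙 ⇝ x)) ⇝ 𝟙  ≡⟨ cong (_⇝ 𝟙) (div₃ 𝟙 x) ⟩
    (x ⊙ (x ⇝ 𝟙)) ⇝ 𝟙  ≡⟨ ⇝-curry _ _ _ ⟩
    (x ⇝ 𝟙) ⇝ (x ⇝ 𝟙)  ≡⟨ ⇝-refl _ ⟩
    𝟙                  ∎

  ≤→⇝≡𝟙 : ∀ {x y} → x ≤ y → x ⇝ y ≡ 𝟙
  ≤→⇝≡𝟙 {x} {y} x≤y = begin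
    x ⇝ y              ≡⟨ cong (_⇝ y) (⊙-⇝-cancel x≤y) ⟩
    (y ⊙ (y ⇝ x)) ⇝ y  ≡⟨ ⇝-curry _ _ _ ⟩
    (y ⇝ x) ⇝ (y ⇝ y)  ≡⟨ cong ((y ⇝ x) ⇝_) (⇝-refl y) ⟩
    (y ⇝ x) ⇝ 𝟙        ≡⟨ x⇝𝟙≡𝟙 _ ⟩
    𝟙                  ∎

  ⇝≡𝟙→≤ : ∀ {x y} → x ⇝ y ≡ 𝟙 → x ≤ y
  ⇝≡𝟙→≤ {x} {y} x⇝y≡𝟙 = begin
    x ⇒ y              ≡⟨ cong (_⇒ y) x≡[y⇒x]⊙y ⟩
    ((y ⇒ x) ⊙ y) ⇒ y  ≡⟨ ⇒-curry _ _ _ ⟩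
    (y ⇒ x) ⇒ (y ⇒ y)  ≡⟨ cong ((y ⇒ x) ⇒_) (⇒-refl y) ⟩
    (y ⇒ x) ⇒ 𝟙        ≡⟨ x⇒𝟙≡𝟙 _ ⟩
    𝟙                  ∎
    where
    x≡[y⇒x]⊙y : x ≡ (y ⇒ x) ⊙ y
    x≡[y⇒x]⊙y = begin
      x            ≡⟨ sym (⊙-identityʳ x) ⟩
      x ⊙ 𝟙        ≡⟨ cong (x ⊙_) (sym x⇝y≡𝟙) ⟩
      x ⊙ (x ⇝ y)  ≡⟨ sym (div₂ x y) ⟩
      (y ⇒ x) ⊙ y  ∎

  ≤-curry⇝ : ∀ {x y z} → (x ⊙ y) ≤ z → y ≤ (x ⇝ z)
  ≤-curry⇝ {x} {y} {z} p = ⇝≡𝟙→≤ (trans (sym (⇝-curry x y z)) (≤→⇝≡𝟙 p))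

  ≤-uncurry⇝ : ∀ {x y z} → y ≤ (x ⇝ z) → (x ⊙ y) ≤ z
  ≤-uncurry⇝ {x} {y} {z} p = ⇝≡𝟙→≤ (trans (⇝-curry x y z) (≤→⇝≡𝟙 p))

  ⇝-mp : ∀ {x y} → (x ⊙ (x ⇝ y)) ≤ y
  ⇝-mp = ≤-uncurry⇝ ≤-refl

  ⊙-monoʳ-≤ : ∀ {w x y} → x ≤ y → (w ⊙ x) ≤ (w ⊙ y)
  ⊙-monoʳ-≤ x≤y = ≤-uncurry⇝ (≤-trans x≤y (≤-curry⇝ ≤-refl))

  ⊙-monoˡ-≤ : ∀ {w x y} → x ≤ y → (x ⊙ w) ≤ (y ⊙ w)
  ⊙-monoˡ-≤ x≤y = ≤-uncurry (≤-trans x≤y (≤-curry ≤-refl))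

  ⇒-antitoneˡ : ∀ {x y z} → x ≤ y → (y ⇒ z) ≤ (x ⇒ z)
  ⇒-antitoneˡ x≤y = ≤-curry (≤-trans (⊙-monoʳ-≤ x≤y) ⇒-mp)

  ⇝-antitoneˡ : ∀ {x y z} → x ≤ y → (y ⇝ z) ≤ (x ⇝ z)
  ⇝-antitoneˡ x≤y = ≤-curry⇝ (≤-trans (⊙-monoˡ-≤ x≤y) ⇝-mp)

  ⇒-postcompose : ∀ {x y z} → (y ⇒ z) ≤ ((x ⇒ y) ⇒ (x ⇒ z))
  ⇒-postcompose {x} {y} {z} =
    subst ((y ⇒ z) ≤_) (⇒-curry (x ⇒ y) x z) (⇒-antitoneˡ ⇒-mp)

  ⇝-postcompose : ∀ {x y z} → (y ⇝ z) ≤ ((x ⇝ y) ⇝ (x ⇝ z))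
  ⇝-postcompose {x} {y} {z} =
    subst ((y ⇝ z) ≤_) (⇝-curry x (x ⇝ y) z) (⇝-antitoneˡ ⇝-mp)

  ⇒-precompose : ∀ {x y z} → (x ⇒ y) ≤ ((y ⇒ z) ⇝ (x ⇒ z))
  ⇒-precompose = ≤-curry⇝ (≤-uncurry ⇒-postcompose)

  ⇝-precompose : ∀ {x y z} → (x ⇝ y) ≤ ((y ⇝ z) ⇒ (x ⇝ z))
  ⇝-precompose = ≤-curry (≤-uncurry⇝ ⇝-postcompose)

  ⇒-postcompose-≤ : ∀ {w x y z} → w ≤ (x ⇒ y) → (y ⇒ z) ≤ (w ⇒ (x ⇒ z))
  ⇒-postcompose-≤ w≤x⇒y = ≤-trans ⇒-postcompose (⇒-antitoneˡ w≤x⇒y)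

  ⇝-postcompose-≤ : ∀ {w x y z} → w ≤ (x ⇝ y) → (y ⇝ z) ≤ (w ⇝ (x ⇝ z))
  ⇝-postcompose-≤ w≤x⇝y = ≤-trans ⇝-postcompose (⇝-antitoneˡ w≤x⇝y)

module BoundedPseudoHoopProperties {a} (A : BoundedPseudoHoop a) where
  open BoundedPseudoHoop A
  open PseudoHoopProperties pseudoHoop

  x≤x⁻∼ : ∀ {x} → x ≤ ((x ⁻) ∼)
  x≤x⁻∼ = ≤-curry⇝ ⇒-mp

  x≤x∼⁻ : ∀ {x} → x ≤ ((x ∼) ⁻)
  x≤x∼⁻ = ≤-curry ⇝-mp

  ⇒-contrapose : ∀ {x y} → (x ⇒ y) ≤ ((y ⁻) ⇝ (x ⁻))
  ⇒-contrapose = ⇒-precompose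

  ⇝-contrapose : ∀ {x y} → (x ⇝ y) ≤ ((y ∼) ⇒ (x ∼))
  ⇝-contrapose = ⇝-precompose

  ⁻⇝⁻-≤-⇒⁻∼ : ∀ {x y} → ((y ⁻) ⇝ (x ⁻)) ≤ (x ⇒ ((y ⁻) ∼))
  ⁻⇝⁻-≤-⇒⁻∼ = ≤-trans ⇝-contrapose (⇒-antitoneˡ x≤x⁻∼)

  ∼⇒∼-≤-⇝∼⁻ : ∀ {x y} → ((y ∼) ⇒ (x ∼)) ≤ (x ⇝ ((y ∼) ⁻))
  ∼⇒∼-≤-⇝∼⁻ = ≤-trans ⇒-contrapose (⇝-antitoneˡ x≤x∼⁻)

module FilterProperties {a ℓ} (P : PseudoHoop a)
  {F : PseudoHoop.Carrier P → Set ℓ} (isFilter : IsFilter P F) where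
  open PseudoHoop P
  open PseudoHoopProperties P
  open IsFilter isFilter

  ∈-⇒-postcompose : ∀ {w x y z} → F (y ⇒ z) → w ≤ (x ⇒ y) → F (w ⇒ (x ⇒ z))
  ∈-⇒-postcompose y⇒z∈F w≤x⇒y = up-closed y⇒z∈F (⇒-postcompose-≤ w≤x⇒y)

  ∈-⇝-postcompose : ∀ {w x y z} → F (y ⇝ z) → w ≤ (x ⇝ y) → F (w ⇝ (x ⇝ z))
  ∈-⇝-postcompose y⇝z∈F w≤x⇝y = up-closed y⇝z∈F (⇝-postcompose-≤ w≤x⇝y)

  ∈-𝟙⇒ : ∀ {x y} → x ≡ 𝟙 → F (x ⇒ y) → F y
  ∈-𝟙⇒ {y = y} refl = subst F (𝟙⇒x≡x y)

  ∈-𝟙⇝ : ∀ {x y} → x ≡ 𝟙 → F (x ⇝ y) → F y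
  ∈-𝟙⇝ {y = y} refl = subst F (𝟙⇝x≡x y)

theorem4p15 : ∀ {a ℓ} (A : BoundedPseudoHoop a) → IsGood A →
    (F : BoundedPseudoHoop.Carrier A → Set ℓ) →
    IsFilter (BoundedPseudoHoop.pseudoHoop A) F →
    let open BoundedPseudoHoop A in
    (IsInvolutive A F ⇔ (∀ x y → F (((y ⁻) ⇝ (x ⁻)) ⇒ (x ⇒ y)) × F (((y ∼) ⇒ (x ∼)) ⇝ (x ⇝ y))))
    × (IsInvolutive A F ⇔ (∀ x y → F (((x ⁻) ⇝ y) ⇒ ((y ∼) ⇒ x)) × F (((x ∼) ⇒ y) ⇝ ((y ⁻) ⇝ x))))
theorem4p15 A _ F isFilter = mk⇔ a⇒b b⇒a , mk⇔ a⇒c c⇒a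
  where
  open BoundedPseudoHoop A
  open PseudoHoopProperties pseudoHoop
  open BoundedPseudoHoopProperties A
  open FilterProperties pseudoHoop isFilter

  Conditionᵇ Conditionᶜ : Set _
  Conditionᵇ = ∀ x y → F (((y ⁻) ⇝ (x ⁻)) ⇒ (x ⇒ y)) × F (((y ∼) ⇒ (x ∼)) ⇝ (x ⇝ y))
  Conditionᶜ = ∀ x y → F (((x ⁻) ⇝ y) ⇒ ((y ∼) ⇒ x)) × F (((x ∼) ⇒ y) ⇝ ((y ⁻) ⇝ x))

  a⇒b : IsInvolutive A F → Conditionᵇ
  a⇒b inv x y = ∈-⇒-postcompose (proj₁ (inv y)) ⁻⇝⁻-≤-⇒⁻∼
              , ∈-⇝-postcompose (proj₂ (inv y)) ∼⇒∼-≤-⇝∼⁻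

  b⇒a : Conditionᵇ → IsInvolutive A F
  b⇒a b x = ∈-𝟙⇒ (≤→⇝≡𝟙 x≤x∼⁻) (proj₁ (b ((x ⁻) ∼) x))
          , ∈-𝟙⇝ x≤x⁻∼ (proj₂ (b ((x ∼) ⁻) x))

  a⇒c : IsInvolutive A F → Conditionᶜ
  a⇒c inv x y = ∈-⇒-postcompose (proj₁ (inv x)) ⇝-contrapose
              , ∈-⇝-postcompose (proj₂ (inv x)) ⇒-contrapose

  c⇒a : Conditionᶜ → IsInvolutive A F
  c⇒a c x = ∈-𝟙⇒ (⇝-refl (x ⁻)) (proj₁ (c x (x ⁻)))
          , ∈-𝟙⇝ (⇒-refl (x ∼)) (proj₂ (c x (x ∼)))
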